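{- Let $m,n\ge 3$ be integers with $m$ odd or $n$ odd. Then $\textup{aw}(C_m\square C_n,3)=3$.
   Context: All graphs are finite, simple and undirected; $\textup{d}(u,v)$ denotes shortest-path distance. $C_n$ is the cycle on $n$ vertices. The Cartesian product $G\square H$ has vertex set $V(G)\times V(H)$, with $(x,y)$ adjacent to $(x',y')$ iff either $x=x'$ and $yy'\in E(H)$, or $y=y'$ and $xx'\in E(G)$. A 3-term arithmetic progression (3-AP) is a set of vertices $\{v_1,v_2,v_3\}$ (listed in some order) with $\textup{d}(v_1,v_2)=\textup{d}(v_2,v_3)$. An exact $r$-coloring of a graph $G$ is a surjective map $c:V(G)\to\{1,\dots,r\}$; a set is rainbow under $c$ if its vertices receive pairwise distinct colors. $\textup{aw}(G,3)$ is the least positive integer $r$ such that every exact $r$-coloring of $G$ contains a rainbow 3-AP; if no coloring yields a rainbow 3-AP, then $\textup{aw}(G,3)=|V(G)|+1$. -}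

module Defs where

open import Data.Nat using (ℕ; zero; suc; _≤_; _<_)
open import Data.Fin using (Fin; toℕ)
open import Data.Product using (_×_; Σ; ∃)
open import Data.Sum using (_⊎_)
open import Relation.Binary.PropositionalEquality using (_≡_; _≢_)
open import Relation.Nullary using (¬_)

record Graph : Set₁ where
  field
    V   : Set
    Adj : V → V → Set

open Graph public

data Walk (G : Graph) : V G → V G → ℕ → Set where
  here : ∀ {u} → Walk G u u zero
  step : ∀ {u w v k} → Adj G u w → Walk G w v k → Walk G u v (suc k)

Dist : (G : Graph) → V G → V G → ℕ → Set
Dist G u v k = Walk G u v k × (∀ j → Walk G u v j → k ≤ j)

-- Cycle C_m on vertex set Fin m: i ~ j iff j = i+1 or i = j+1 (mod m).
CycAdj : (m : ℕ) → Fin m → Fin m → Set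
CycAdj m i j =
  (suc (toℕ i) ≡ toℕ j) ⊎ (suc (toℕ j) ≡ toℕ i)
  ⊎ ((toℕ i ≡ 0 × suc (toℕ j) ≡ m) ⊎ (toℕ j ≡ 0 × suc (toℕ i) ≡ m))

Cycle : ℕ → Graph
Cycle m = record { V = Fin m ; Adj = CycAdj m }

_□_ : Graph → Graph → Graph
G □ H = record
  { V   = V G × V H
  ; Adj = λ p q →
      (Data.Product.proj₁ p ≡ Data.Product.proj₁ q × Adj H (Data.Product.proj₂ p) (Data.Product.proj₂ q))
      ⊎ (Data.Product.proj₂ p ≡ Data.Product.proj₂ q × Adj G (Data.Product.proj₁ p) (Data.Product.proj₁ q))
  }

-- Exact r-coloring: surjective map onto the r colors (Fin r ≅ {1,…,r}).
Surjective : {A B : Set} → (A → B) → Set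
Surjective {A} {B} f = ∀ (b : B) → Σ A (λ a → f a ≡ b)

-- c has a rainbow 3-AP: vertices v1,v2,v3 with d(v1,v2) = d(v2,v3)
-- and pairwise distinct colours (hence pairwise distinct vertices).
HasRainbow3AP : (G : Graph) {r : ℕ} → (V G → Fin r) → Set
HasRainbow3AP G c =
  Σ (V G) λ v1 → Σ (V G) λ v2 → Σ (V G) λ v3 → Σ ℕ λ k →
    Dist G v1 v2 k × Dist G v2 v3 k ×
    c v1 ≢ c v2 × c v2 ≢ c v3 × c v1 ≢ c v3

EveryExactColoringRainbow : Graph → ℕ → Set
EveryExactColoringRainbow G r =
  (c : V G → Fin r) → Surjective c → HasRainbow3AP G c

-- aw(G,3) = r : r is the least positive integer with the property.
-- (For a graph on N vertices, r = N+1 vacuously has the property, so this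
--  agrees with the convention aw = N+1 when no coloring has a rainbow 3-AP.)
IsAW3 : Graph → ℕ → Set
IsAW3 G r = 1 ≤ r × EveryExactColoringRainbow G r
          × (∀ s → 1 ≤ s → s < r → ¬ EveryExactColoringRainbow G s)

-- Let the first factor be the odd cycle C_(2k+1) (an odd second factor is handled by swapping
-- the factors) and let c be an exact 3-colouring without rainbow 3-AP; the graph distance is
-- the sum of the two cyclic distances.  The basic tool: if u and w are equidistant from each
-- of two centres whose colours differ from each other and from c u, then c w = c u.
--
-- If every horizontal edge is monochromatic, c only depends on the row; a vertex of the third
-- colour is at distances differing by at most one from two adjacent rows of different
-- colours, and a horizontal step of length one levels them.  Otherwise take a bichromatic
-- horizontal edge and an apex of the third colour.  As the cycle is odd, one column is at
-- distance k from both ends of the edge, so the apex cannot lie in it.  Moving the apex one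
-- step towards that column, the colour found there yields a configuration whose apex is one
-- step closer to its own equidistant column: directly, or after sliding one end of the edge
-- one row towards the apex.  That slide is impossible only if the apex lies in the row of the
-- edge; then the colours x, y, z, x appear at columns s, s+1, s+g+1, s+g+2, and this pattern
-- climbs row by row, its gap shrinking by two each time, until it is itself a rainbow 3-AP.
--
-- The rainbow 3-AP is produced by exhaustive search; the argument refutes its absence.

module Submission where

open import Defs
open import Data.Nat using (ℕ; _≤_)
open import Data.Nat.Divisibility using (_∣_; m%n≡0⇒n∣m)
open import Data.Sum using (_⊎_; inj₁; inj₂)
open import Relation.Nullary using (¬_; Dec; yes; no)

open import Data.Empty using (⊥; ⊥-elim)
open import Data.Fin using (Fin; zero; suc; toℕ; opposite)
open import Data.Fin.Properties
  using (toℕ-fromℕ<; toℕ-injective; toℕ<n; opposite-prop; opposite-involutive; _≟_; any?)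
open import Data.List using ([]; _∷_)
open import Data.Nat
  using (zero; suc; _+_; _*_; _∸_; _⊓_; _<_; ∣_-_∣; z≤n; s≤s; NonZero; >-nonZero; _≤?_; _<?_)
open import Data.Nat.DivMod
  using (_%_; _/_; _mod_; m≡m%n+[m/n]*n; m%n<n; m<n⇒m%n≡m; %-distribˡ-+; m%n%n≡m%n; [m+n]%n≡m%n; n%n≡0)
open import Data.Nat.Properties hiding (_≟_)
import Data.Nat.Properties as ℕ
open import Data.Nat.Tactic.RingSolver using (solve)
open import Data.Product using (Σ; ∃; _×_; _,_; proj₁; proj₂; swap)
open import Function using (_∘_)
open import Relation.Binary.Definitions using (Tri; tri<; tri≈; tri>)
open import Relation.Binary.PropositionalEquality
open import Relation.Nullary.Decidable using (map′; _×-dec_; ¬?; decidable-stable)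

module _ {G : Graph} where

  walk-++ : ∀ {u v w a b} → Walk G u v a → Walk G v w b → Walk G u w (a + b)
  walk-++ here q = q
  walk-++ (step e p) q = step e (walk-++ p q)

  walk-snoc : ∀ {u v w k} → Walk G u v k → Adj G v w → Walk G u w (suc k)
  walk-snoc here e = step e here
  walk-snoc (step e′ p) e = step e′ (walk-snoc p e)

  walk-reverse : (∀ {u v} → Adj G u v → Adj G v u) → ∀ {u v k} → Walk G u v k → Walk G v u k
  walk-reverse sym-adj here = here
  walk-reverse sym-adj (step e p) = walk-snoc (walk-reverse sym-adj p) (sym-adj e)

module _ (G : Graph) (δ : V G → V G → ℕ) (δ-refl : ∀ v → δ v v ≡ 0)
         (δ-adj : ∀ {u w} → Adj G u w → ∀ v → δ u v ≤ suc (δ w v)) where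

  lipschitz⇒≤length : ∀ {u v j} → Walk G u v j → δ u v ≤ j
  lipschitz⇒≤length {v = v} here = ≤-reflexive (δ-refl v)
  lipschitz⇒≤length {v = v} (step e p) = ≤-trans (δ-adj e v) (s≤s (lipschitz⇒≤length p))

  lipschitz⇒Dist : ∀ {u v} → Walk G u v (δ u v) → Dist G u v (δ u v)
  lipschitz⇒Dist w = w , λ _ → lipschitz⇒≤length

Distinct3 : {A : Set} → A → A → A → Set
Distinct3 x y z = x ≢ y × y ≢ z × x ≢ z

Distinct3-cong : ∀ {A : Set} {x x′ y y′ z z′ : A} → x ≡ x′ → y ≡ y′ → z ≡ z′ → Distinct3 x y z → Distinct3 x′ y′ z′
Distinct3-cong refl refl refl distinct = distinct

Distinct3-swap₁₂ : ∀ {A : Set} {x y z : A} → Distinct3 x y z → Distinct3 y x z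
Distinct3-swap₁₂ (x≢y , y≢z , x≢z) = x≢y ∘ sym , x≢z , y≢z

Rainbow3AP : {A : Set} {r : ℕ} → (A → A → ℕ) → (A → Fin r) → Set
Rainbow3AP {A} δ c = Σ A λ v₁ → Σ A λ v₂ → Σ A λ v₃ →
  δ v₁ v₂ ≡ δ v₂ v₃ × Distinct3 (c v₁) (c v₂) (c v₃)

Rainbow3AP⇒HasRainbow3AP : ∀ (G : Graph) {r} (δ : V G → V G → ℕ) {c : V G → Fin r} →
  (∀ u v → Dist G u v (δ u v)) → Rainbow3AP δ c → HasRainbow3AP G c
Rainbow3AP⇒HasRainbow3AP G δ dist (v₁ , v₂ , v₃ , δ≡ , c₁≢c₂ , c₂≢c₃ , c₁≢c₃) =
  v₁ , v₂ , v₃ , δ v₁ v₂ , dist v₁ v₂ , subst (Dist G v₂ v₃) (sym δ≡) (dist v₂ v₃) , c₁≢c₂ , c₂≢c₃ , c₁≢c₃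

Rainbow3AP-isometry : ∀ {A B : Set} {r} {δA : A → A → ℕ} {δB : B → B → ℕ} {c : B → Fin r}
  (f : A → B) → (∀ u v → δB (f u) (f v) ≡ δA u v) → Rainbow3AP δA (c ∘ f) → Rainbow3AP δB c
Rainbow3AP-isometry f isometry (v₁ , v₂ , v₃ , δ≡ , distinct) =
  f v₁ , f v₂ , f v₃ , trans (isometry v₁ v₂) (trans δ≡ (sym (isometry v₂ v₃))) , distinct

module _ {A : Set} {r : ℕ} {δ : A → A → ℕ} {c : A → Fin r} (rainbow-free : ¬ Rainbow3AP δ c) where

  colour-between : ∀ {u v w} → δ u v ≡ δ v w → c u ≢ c v → c w ≡ c u ⊎ c w ≡ c v
  colour-between {u} {v} {w} δ≡ u≢v with c w ≟ c u | c w ≟ c v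
  ... | yes w≡u | _ = inj₁ w≡u
  ... | no _ | yes w≡v = inj₂ w≡v
  ... | no w≢u | no w≢v = ⊥-elim (rainbow-free (u , v , w , δ≡ , u≢v , w≢v ∘ sym , w≢u ∘ sym))

  pinned : ∀ {u v v′ w} → δ u v ≡ δ v w → δ u v′ ≡ δ v′ w → Distinct3 (c u) (c v) (c v′) → c w ≡ c u
  pinned δ≡ δ′≡ (u≢v , v≢v′ , u≢v′) with colour-between δ≡ u≢v | colour-between δ′≡ u≢v′
  ... | inj₁ w≡u | _ = w≡u
  ... | inj₂ _ | inj₁ w≡u = w≡u
  ... | inj₂ w≡v | inj₂ w≡v′ = ⊥-elim (v≢v′ (trans (sym w≡v) w≡v′))

third-colour : (x y : Fin 3) → x ≢ y → ∃ λ z → Distinct3 x y z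
third-colour zero zero x≢y = ⊥-elim (x≢y refl)
third-colour zero (suc zero) x≢y = suc (suc zero) , x≢y , (λ ()) , (λ ())
third-colour zero (suc (suc zero)) x≢y = suc zero , x≢y , (λ ()) , (λ ())
third-colour (suc zero) zero x≢y = suc (suc zero) , x≢y , (λ ()) , (λ ())
third-colour (suc zero) (suc zero) x≢y = ⊥-elim (x≢y refl)
third-colour (suc zero) (suc (suc zero)) x≢y = zero , x≢y , (λ ()) , (λ ())
third-colour (suc (suc zero)) zero x≢y = suc zero , x≢y , (λ ()) , (λ ())
third-colour (suc (suc zero)) (suc zero) x≢y = zero , x≢y , (λ ()) , (λ ())
third-colour (suc (suc zero)) (suc (suc zero)) x≢y = ⊥-elim (x≢y refl)

module CycleGeometry (N : ℕ) .{{_ : NonZero N}} where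

  infixl 6 _⊕_
  _⊕_ : Fin N → ℕ → Fin N
  i ⊕ t = (toℕ i + t) mod N

  toℕ-⊕ : ∀ i t → toℕ (i ⊕ t) ≡ (toℕ i + t) % N
  toℕ-⊕ i t = toℕ-fromℕ< (m%n<n (toℕ i + t) N)

  toℕ-⊕-< : ∀ i t → toℕ i + t < N → toℕ (i ⊕ t) ≡ toℕ i + t
  toℕ-⊕-< i t lt = trans (toℕ-⊕ i t) (m<n⇒m%n≡m lt)

  private
    %-absorbˡ : ∀ m t → (m % N + t) % N ≡ (m + t) % N
    %-absorbˡ m t = begin
      (m % N + t) % N           ≡⟨ %-distribˡ-+ (m % N) t N ⟩
      (m % N % N + t % N) % N   ≡⟨ cong (λ x → (x + t % N) % N) (m%n%n≡m%n m N) ⟩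
      (m % N + t % N) % N       ≡⟨ %-distribˡ-+ m t N ⟨
      (m + t) % N               ∎
      where open ≡-Reasoning

  ⊕-assoc : ∀ i s t → (i ⊕ s) ⊕ t ≡ i ⊕ (s + t)
  ⊕-assoc i s t = toℕ-injective (begin
    toℕ ((i ⊕ s) ⊕ t)          ≡⟨ toℕ-⊕ (i ⊕ s) t ⟩
    (toℕ (i ⊕ s) + t) % N      ≡⟨ cong (λ x → (x + t) % N) (toℕ-⊕ i s) ⟩
    ((toℕ i + s) % N + t) % N  ≡⟨ %-absorbˡ (toℕ i + s) t ⟩
    (toℕ i + s + t) % N        ≡⟨ cong (_% N) (+-assoc (toℕ i) s t) ⟩
    (toℕ i + (s + t)) % N      ≡⟨ toℕ-⊕ i (s + t) ⟨
    toℕ (i ⊕ (s + t))          ∎)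
    where open ≡-Reasoning

  ⊕-suc : ∀ i t → (i ⊕ t) ⊕ 1 ≡ i ⊕ suc t
  ⊕-suc i t = trans (⊕-assoc i t 1) (cong (i ⊕_) (+-comm t 1))

  ⊕-identityʳ : ∀ i → i ⊕ 0 ≡ i
  ⊕-identityʳ i = toℕ-injective (trans (toℕ-⊕-< i 0 (subst (_< N) (sym (+-identityʳ _)) (toℕ<n i))) (+-identityʳ (toℕ i)))

  ⊕-period : ∀ i t → i ⊕ (N + t) ≡ i ⊕ t
  ⊕-period i t = toℕ-injective (begin
    toℕ (i ⊕ (N + t))     ≡⟨ toℕ-⊕ i (N + t) ⟩
    (toℕ i + (N + t)) % N ≡⟨ cong (_% N) (trans (cong (toℕ i +_) (+-comm N t)) (sym (+-assoc (toℕ i) t N))) ⟩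
    (toℕ i + t + N) % N   ≡⟨ [m+n]%n≡m%n (toℕ i + t) N ⟩
    (toℕ i + t) % N       ≡⟨ toℕ-⊕ i t ⟨
    toℕ (i ⊕ t)           ∎)
    where open ≡-Reasoning

  ⊕-periodʳ : ∀ i → i ⊕ N ≡ i
  ⊕-periodʳ i = trans (cong (i ⊕_) (sym (+-identityʳ N))) (trans (⊕-period i 0) (⊕-identityʳ i))

  ⊕-surjective : ∀ i j → ∃ λ t → t < N × j ≡ i ⊕ t
  ⊕-surjective i j with toℕ i ≤? toℕ j
  ... | yes i≤j = toℕ j ∸ toℕ i , ≤-<-trans (m∸n≤m (toℕ j) (toℕ i)) (toℕ<n j) ,
        toℕ-injective (sym (trans (toℕ-⊕-< i _ (subst (_< N) (sym (m+[n∸m]≡n i≤j)) (toℕ<n j))) (m+[n∸m]≡n i≤j)))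
  ... | no i≰j = toℕ j + (N ∸ toℕ i) , t<N , toℕ-injective (sym (begin
      toℕ (i ⊕ (toℕ j + (N ∸ toℕ i)))  ≡⟨ toℕ-⊕ i _ ⟩
      (toℕ i + (toℕ j + (N ∸ toℕ i))) % N ≡⟨ cong (_% N) rearrange ⟩
      (toℕ j + N) % N                  ≡⟨ [m+n]%n≡m%n (toℕ j) N ⟩
      toℕ j % N                        ≡⟨ m<n⇒m%n≡m (toℕ<n j) ⟩
      toℕ j                            ∎))
    where
    open ≡-Reasoning
    i+[N∸i]≡N : toℕ i + (N ∸ toℕ i) ≡ N
    i+[N∸i]≡N = m+[n∸m]≡n (<⇒≤ (toℕ<n i))
    t<N : toℕ j + (N ∸ toℕ i) < N
    t<N = subst (toℕ j + (N ∸ toℕ i) <_) i+[N∸i]≡N (+-monoˡ-< (N ∸ toℕ i) (≰⇒> i≰j))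
    rearrange : toℕ i + (toℕ j + (N ∸ toℕ i)) ≡ toℕ j + N
    rearrange = begin
      toℕ i + (toℕ j + (N ∸ toℕ i)) ≡⟨ cong (toℕ i +_) (+-comm (toℕ j) _) ⟩
      toℕ i + ((N ∸ toℕ i) + toℕ j) ≡⟨ +-assoc (toℕ i) _ (toℕ j) ⟨
      toℕ i + (N ∸ toℕ i) + toℕ j   ≡⟨ cong (_+ toℕ j) i+[N∸i]≡N ⟩
      N + toℕ j                     ≡⟨ +-comm N (toℕ j) ⟩
      toℕ j + N                     ∎

  arc : ℕ → ℕ
  arc t = t ⊓ (N ∸ t)

  cycDist : Fin N → Fin N → ℕ
  cycDist i j = arc ∣ toℕ i - toℕ j ∣

  cycDist-sym : ∀ i j → cycDist i j ≡ cycDist j i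
  cycDist-sym i j = cong arc (∣-∣-comm (toℕ i) (toℕ j))

  cycDist-refl : ∀ i → cycDist i i ≡ 0
  cycDist-refl i = cong arc (∣n-n∣≡0 (toℕ i))

  arc-complement : ∀ t s → t + s ≡ N → arc s ≡ arc t
  arc-complement t s t+s≡N = begin
    s ⊓ (N ∸ s)     ≡⟨ cong (λ x → s ⊓ (x ∸ s)) (sym t+s≡N) ⟩
    s ⊓ (t + s ∸ s) ≡⟨ cong (s ⊓_) (m+n∸n≡m t s) ⟩
    s ⊓ t           ≡⟨ ⊓-comm s t ⟩
    t ⊓ s           ≡⟨ cong (t ⊓_) (m+n∸m≡n t s) ⟨
    t ⊓ (t + s ∸ t) ≡⟨ cong (λ x → t ⊓ (x ∸ t)) t+s≡N ⟩
    t ⊓ (N ∸ t)     ∎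
    where open ≡-Reasoning

  arc-small : ∀ {t} → t ≤ N ∸ t → arc t ≡ t
  arc-small = m≤n⇒m⊓n≡m

  arc-large : ∀ {t} → N ∸ t ≤ t → arc t ≡ N ∸ t
  arc-large = m≥n⇒m⊓n≡n

  cycDist-⊕ : ∀ i t → t ≤ N → cycDist i (i ⊕ t) ≡ arc t
  cycDist-⊕ i t t≤N with toℕ i + t <? N
  ... | yes no-wrap = begin
    arc ∣ toℕ i - toℕ (i ⊕ t) ∣ ≡⟨ cong (λ x → arc ∣ toℕ i - x ∣) (toℕ-⊕-< i t no-wrap) ⟩
    arc ∣ toℕ i - toℕ i + t ∣   ≡⟨ cong arc (∣m-m+n∣≡n (toℕ i) t) ⟩
    arc t                       ∎
    where open ≡-Reasoning
  ... | no wrap = begin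
    arc ∣ u - toℕ (i ⊕ t) ∣ ≡⟨ cong (λ x → arc ∣ u - x ∣) (trans (toℕ-⊕ i t) u+t%N≡w) ⟩
    arc ∣ u - w ∣           ≡⟨ cong (λ x → arc ∣ x - w ∣) u≡s+w ⟩
    arc ∣ s + w - w ∣       ≡⟨ cong arc (trans (∣-∣-comm (s + w) w) (trans (cong (∣ w -_∣) (+-comm s w)) (∣m-m+n∣≡n w s))) ⟩
    arc s                   ≡⟨ arc-complement t s (m+[n∸m]≡n t≤N) ⟩
    arc t                   ∎
    where
    open ≡-Reasoning
    u = toℕ i
    s = N ∸ t
    w = u + t ∸ N
    u+t≡w+N : u + t ≡ w + N
    u+t≡w+N = sym (m∸n+n≡m (≮⇒≥ wrap))
    u≡s+w : u ≡ s + w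
    u≡s+w = +-cancelʳ-≡ t u (s + w) (begin
      u + t           ≡⟨ u+t≡w+N ⟩
      w + N           ≡⟨ cong (w +_) (m+[n∸m]≡n t≤N) ⟨
      w + (t + s)     ≡⟨ cong (w +_) (+-comm t s) ⟩
      w + (s + t)     ≡⟨ +-assoc w s t ⟨
      w + s + t       ≡⟨ cong (_+ t) (+-comm w s) ⟩
      s + w + t       ∎)
    u+t%N≡w : (u + t) % N ≡ w
    u+t%N≡w = begin
      (u + t) % N ≡⟨ cong (_% N) u+t≡w+N ⟩
      (w + N) % N ≡⟨ [m+n]%n≡m%n w N ⟩
      w % N       ≡⟨ m<n⇒m%n≡m (≤-<-trans (subst (w ≤_) (sym u≡s+w) (m≤n+m w s)) (toℕ<n i)) ⟩
      w           ∎

  cycDist≡⇒⊕ : ∀ i j δ → cycDist i j ≡ δ → j ≡ i ⊕ δ ⊎ i ≡ j ⊕ δ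
  cycDist≡⇒⊕ i j δ d≡δ with ⊕-surjective i j
  ... | t , t<N , refl with ≤-total t (N ∸ t)
  ...   | inj₁ small = inj₁ (cong (i ⊕_) (begin
    t                  ≡⟨ arc-small small ⟨
    arc t              ≡⟨ cycDist-⊕ i t (<⇒≤ t<N) ⟨
    cycDist i (i ⊕ t)  ≡⟨ d≡δ ⟩
    δ                  ∎))
    where open ≡-Reasoning
  ...   | inj₂ large = inj₂ (sym (begin
    (i ⊕ t) ⊕ δ        ≡⟨ cong ((i ⊕ t) ⊕_) δ≡N∸t ⟩
    (i ⊕ t) ⊕ (N ∸ t)  ≡⟨ ⊕-assoc i t (N ∸ t) ⟩
    i ⊕ (t + (N ∸ t))  ≡⟨ cong (i ⊕_) (m+[n∸m]≡n (<⇒≤ t<N)) ⟩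
    i ⊕ N              ≡⟨ ⊕-periodʳ i ⟩
    i                  ∎))
    where
    open ≡-Reasoning
    δ≡N∸t : δ ≡ N ∸ t
    δ≡N∸t = trans (sym d≡δ) (trans (cycDist-⊕ i t (<⇒≤ t<N)) (arc-large large))

  cycDist≡0⇒≡ : ∀ {i j} → cycDist i j ≡ 0 → i ≡ j
  cycDist≡0⇒≡ {i} {j} d≡0 with cycDist≡⇒⊕ i j 0 d≡0
  ... | inj₁ j≡i⊕0 = sym (trans j≡i⊕0 (⊕-identityʳ i))
  ... | inj₂ i≡j⊕0 = trans i≡j⊕0 (⊕-identityʳ j)

  arc-suc : ∀ t → suc t ≤ N → arc (suc t) ≤ suc (arc t) × arc t ≤ suc (arc (suc t))
  arc-suc t t<N rewrite +-∸-assoc 1 t<N =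
    ⊓-mono-≤ (≤-refl {suc t}) (m≤n+m (N ∸ suc t) 2) , ⊓-mono-≤ (m≤n+m t 2) (≤-refl {suc (N ∸ suc t)})

  cycDist-⊕1-≤ : ∀ j y → cycDist j (y ⊕ 1) ≤ suc (cycDist j y) × cycDist j y ≤ suc (cycDist j (y ⊕ 1))
  cycDist-⊕1-≤ j y with ⊕-surjective j y
  ... | t , t<N , refl = subst₂ (λ a b → a ≤ suc b × b ≤ suc a) (sym d₊) (sym d) (arc-suc t t<N)
    where
    d : cycDist j (j ⊕ t) ≡ arc t
    d = cycDist-⊕ j t (<⇒≤ t<N)
    d₊ : cycDist j ((j ⊕ t) ⊕ 1) ≡ arc (suc t)
    d₊ = trans (cong (cycDist j) (⊕-suc j t)) (cycDist-⊕ j (suc t) t<N)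

  private
    toℕ-⊕1 : ∀ i → toℕ (i ⊕ 1) ≡ suc (toℕ i) % N
    toℕ-⊕1 i = trans (toℕ-⊕ i 1) (cong (_% N) (+-comm (toℕ i) 1))

    successor : ∀ {i j} → suc (toℕ i) ≡ toℕ j → j ≡ i ⊕ 1
    successor {i} {j} e = toℕ-injective (sym (trans (toℕ-⊕1 i) (trans (cong (_% N) e) (m<n⇒m%n≡m (toℕ<n j)))))

    wrap-successor : ∀ {i j} → toℕ j ≡ 0 → suc (toℕ i) ≡ N → j ≡ i ⊕ 1
    wrap-successor {i} {j} j≡0 e = toℕ-injective (sym (trans (toℕ-⊕1 i) (trans (cong (_% N) e) (trans (n%n≡0 N) (sym j≡0)))))

  ⊕1-adjacent : ∀ i → CycAdj N i (i ⊕ 1)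
  ⊕1-adjacent i with suc (toℕ i) <? N
  ... | yes i+1<N = inj₁ (sym (trans (toℕ-⊕1 i) (m<n⇒m%n≡m i+1<N)))
  ... | no i+1≮N = inj₂ (inj₂ (inj₂ (trans (toℕ-⊕1 i) (trans (cong (_% N) i+1≡N) (n%n≡0 N)) , i+1≡N)))
    where
    i+1≡N : suc (toℕ i) ≡ N
    i+1≡N = ≤-antisym (toℕ<n i) (≮⇒≥ i+1≮N)

  adjacent⇒⊕1 : ∀ {i j} → CycAdj N i j → j ≡ i ⊕ 1 ⊎ i ≡ j ⊕ 1
  adjacent⇒⊕1 (inj₁ e) = inj₁ (successor e)
  adjacent⇒⊕1 (inj₂ (inj₁ e)) = inj₂ (successor e)
  adjacent⇒⊕1 (inj₂ (inj₂ (inj₁ (i≡0 , e)))) = inj₂ (wrap-successor i≡0 e)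
  adjacent⇒⊕1 (inj₂ (inj₂ (inj₂ (j≡0 , e)))) = inj₁ (wrap-successor j≡0 e)

  CycAdj-sym : ∀ {i j} → CycAdj N i j → CycAdj N j i
  CycAdj-sym (inj₁ e) = inj₂ (inj₁ e)
  CycAdj-sym (inj₂ (inj₁ e)) = inj₁ e
  CycAdj-sym (inj₂ (inj₂ (inj₁ e))) = inj₂ (inj₂ (inj₂ e))
  CycAdj-sym (inj₂ (inj₂ (inj₂ e))) = inj₂ (inj₂ (inj₁ e))

  cycDist-adjacent-≤ : ∀ {i i′} → CycAdj N i i′ → ∀ j → cycDist i j ≤ suc (cycDist i′ j)
  cycDist-adjacent-≤ {i} {i′} a j with adjacent⇒⊕1 a
  ... | inj₁ refl = subst₂ (λ x y → x ≤ suc y) (cycDist-sym j i) (cycDist-sym j (i ⊕ 1)) (proj₂ (cycDist-⊕1-≤ j i))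
  ... | inj₂ refl = subst₂ (λ x y → x ≤ suc y) (cycDist-sym j (i′ ⊕ 1)) (cycDist-sym j i′) (proj₁ (cycDist-⊕1-≤ j i′))

  cycDist-⊕1≡1 : 2 ≤ N → ∀ i → cycDist i (i ⊕ 1) ≡ 1
  cycDist-⊕1≡1 2≤N i = trans (cycDist-⊕ i 1 (≤-trans (s≤s z≤n) 2≤N)) (arc-small (m+n≤o⇒m≤o∸n 1 2≤N))

  cycDist-adjacent : 2 ≤ N → ∀ {i j} → CycAdj N i j → cycDist i j ≡ 1
  cycDist-adjacent 2≤N {i} {j} a with adjacent⇒⊕1 a
  ... | inj₁ refl = cycDist-⊕1≡1 2≤N i
  ... | inj₂ refl = trans (cycDist-sym (j ⊕ 1) j) (cycDist-⊕1≡1 2≤N j)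

  walk-⊕ : ∀ i t → Walk (Cycle N) i (i ⊕ t) t
  walk-⊕ i zero = subst (λ j → Walk (Cycle N) i j 0) (sym (⊕-identityʳ i)) here
  walk-⊕ i (suc t) = step (⊕1-adjacent i) (subst (λ j → Walk (Cycle N) (i ⊕ 1) j t) (⊕-assoc i 1 t) (walk-⊕ (i ⊕ 1) t))

  walk-cycDist : ∀ i j → Walk (Cycle N) i j (cycDist i j)
  walk-cycDist i j with ⊕-surjective i j
  ... | t , t<N , refl with ≤-total t (N ∸ t)
  ...   | inj₁ small = subst (Walk (Cycle N) i (i ⊕ t)) (sym (trans (cycDist-⊕ i t (<⇒≤ t<N)) (arc-small small))) (walk-⊕ i t)
  ...   | inj₂ large = subst (Walk (Cycle N) i (i ⊕ t)) (sym (trans (cycDist-⊕ i t (<⇒≤ t<N)) (arc-large large)))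
                         (walk-reverse CycAdj-sym (subst (λ j → Walk (Cycle N) (i ⊕ t) j (N ∸ t)) back (walk-⊕ (i ⊕ t) (N ∸ t))))
    where
    back : (i ⊕ t) ⊕ (N ∸ t) ≡ i
    back = trans (⊕-assoc i t (N ∸ t)) (trans (cong (i ⊕_) (m+[n∸m]≡n (<⇒≤ t<N))) (⊕-periodʳ i))

  step-toward : 2 ≤ N → ∀ {i j} → i ≢ j → ∃ λ i′ → cycDist i i′ ≡ 1 × suc (cycDist i′ j) ≡ cycDist i j
  step-toward 2≤N {i} {j} i≢j with cycDist i j in d≡ | walk-cycDist i j
  ... | zero  | _ = ⊥-elim (i≢j (cycDist≡0⇒≡ d≡))
  ... | suc n | step {w = i′} a w = i′ , cycDist-adjacent 2≤N a ,
        ≤-antisym (s≤s (lipschitz⇒≤length (Cycle N) cycDist cycDist-refl cycDist-adjacent-≤ w))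
                  (subst (_≤ suc (cycDist i′ j)) d≡ (cycDist-adjacent-≤ a j))

  ⊕1-invariant⇒constant : ∀ {A : Set} (g : Fin N → A) → (∀ i → g (i ⊕ 1) ≡ g i) → ∀ i j → g j ≡ g i
  ⊕1-invariant⇒constant g inv i j with ⊕-surjective i j
  ... | t , _ , refl = along t
    where
    along : ∀ t → g (i ⊕ t) ≡ g i
    along zero = cong g (⊕-identityʳ i)
    along (suc t) = trans (cong g (sym (⊕-suc i t))) (trans (inv (i ⊕ t)) (along t))

  mirror : Fin N → Fin N
  mirror = opposite

  mirror-⊕1 : ∀ i → mirror (i ⊕ 1) ⊕ 1 ≡ mirror i
  mirror-⊕1 i = toℕ-injective (begin
    toℕ (mirror (i ⊕ 1) ⊕ 1)        ≡⟨ toℕ-⊕1 (mirror (i ⊕ 1)) ⟩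
    suc (toℕ (mirror (i ⊕ 1))) % N  ≡⟨ cong (λ x → suc x % N) (opposite-prop (i ⊕ 1)) ⟩
    suc (N ∸ suc (toℕ (i ⊕ 1))) % N ≡⟨ by-wrap (suc (toℕ i) <? N) ⟩
    N ∸ suc (toℕ i)                 ≡⟨ opposite-prop i ⟨
    toℕ (mirror i)                  ∎)
    where
    open ≡-Reasoning
    by-wrap : Dec (suc (toℕ i) < N) → suc (N ∸ suc (toℕ (i ⊕ 1))) % N ≡ N ∸ suc (toℕ i)
    by-wrap (yes i+1<N) = begin
      suc (N ∸ suc (toℕ (i ⊕ 1))) % N  ≡⟨ cong (λ x → suc (N ∸ suc x) % N) (trans (toℕ-⊕1 i) (m<n⇒m%n≡m i+1<N)) ⟩
      suc (N ∸ suc (suc (toℕ i))) % N  ≡⟨ cong (_% N) (+-∸-assoc 1 i+1<N) ⟨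
      (N ∸ suc (toℕ i)) % N            ≡⟨ m<n⇒m%n≡m (∸-monoʳ-< (s≤s z≤n) (toℕ<n i)) ⟩
      N ∸ suc (toℕ i)                  ∎
    by-wrap (no i+1≮N) = begin
      suc (N ∸ suc (toℕ (i ⊕ 1))) % N  ≡⟨ cong (λ x → suc (N ∸ suc x) % N) (trans (toℕ-⊕1 i) (trans (cong (_% N) i+1≡N) (n%n≡0 N))) ⟩
      suc (N ∸ 1) % N                  ≡⟨ cong (_% N) (+-∸-assoc 1 (≤-trans (s≤s z≤n) (toℕ<n i))) ⟨
      N % N                            ≡⟨ n%n≡0 N ⟩
      0                                ≡⟨ trans (cong (N ∸_) i+1≡N) (n∸n≡0 N) ⟨
      N ∸ suc (toℕ i)                  ∎
      where
      i+1≡N : suc (toℕ i) ≡ N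
      i+1≡N = ≤-antisym (toℕ<n i) (≮⇒≥ i+1≮N)

  mirror-⊕ : ∀ i t → mirror (i ⊕ t) ⊕ t ≡ mirror i
  mirror-⊕ i zero = trans (⊕-identityʳ _) (cong mirror (⊕-identityʳ i))
  mirror-⊕ i (suc t) = begin
    mirror (i ⊕ suc t) ⊕ suc t      ≡⟨ cong (λ x → mirror x ⊕ suc t) (⊕-suc i t) ⟨
    mirror (i ⊕ t ⊕ 1) ⊕ (1 + t)    ≡⟨ ⊕-assoc (mirror (i ⊕ t ⊕ 1)) 1 t ⟨
    mirror (i ⊕ t ⊕ 1) ⊕ 1 ⊕ t      ≡⟨ cong (_⊕ t) (mirror-⊕1 (i ⊕ t)) ⟩
    mirror (i ⊕ t) ⊕ t              ≡⟨ mirror-⊕ i t ⟩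
    mirror i                        ∎
    where open ≡-Reasoning

  mirror-⊕-flip : ∀ {x y} t → x ⊕ t ≡ y → mirror (mirror y ⊕ t) ≡ x
  mirror-⊕-flip {x} t refl = trans (cong mirror (mirror-⊕ x t)) (opposite-involutive x)

  cycDist-mirror : ∀ i j → cycDist (mirror i) (mirror j) ≡ cycDist i j
  cycDist-mirror i j with ⊕-surjective i j
  ... | t , t<N , refl = begin
    cycDist (mirror i) (mirror (i ⊕ t))         ≡⟨ cong (λ x → cycDist x (mirror (i ⊕ t))) (mirror-⊕ i t) ⟨
    cycDist (mirror (i ⊕ t) ⊕ t) (mirror (i ⊕ t)) ≡⟨ cycDist-sym (mirror (i ⊕ t) ⊕ t) (mirror (i ⊕ t)) ⟩
    cycDist (mirror (i ⊕ t)) (mirror (i ⊕ t) ⊕ t) ≡⟨ cycDist-⊕ (mirror (i ⊕ t)) t (<⇒≤ t<N) ⟩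
    arc t                                       ≡⟨ cycDist-⊕ i t (<⇒≤ t<N) ⟨
    cycDist i (i ⊕ t)                           ∎
    where open ≡-Reasoning

module Torus (m n : ℕ) .{{_ : NonZero m}} .{{_ : NonZero n}} where
  module X = CycleGeometry m
  module Y = CycleGeometry n

  Vertex : Set
  Vertex = Fin m × Fin n

  torusDist : Vertex → Vertex → ℕ
  torusDist (x , y) (x′ , y′) = X.cycDist x x′ + Y.cycDist y y′

  private
    torusDist-refl : ∀ v → torusDist v v ≡ 0
    torusDist-refl (x , y) = cong₂ _+_ (X.cycDist-refl x) (Y.cycDist-refl y)

    torusDist-adjacent-≤ : ∀ {u w} → Adj (Cycle m □ Cycle n) u w → ∀ v → torusDist u v ≤ suc (torusDist w v)
    torusDist-adjacent-≤ {x , y} {.x , y′} (inj₁ (refl , a)) (x″ , y″) =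
      subst (X.cycDist x x″ + Y.cycDist y y″ ≤_) (+-suc (X.cycDist x x″) (Y.cycDist y′ y″))
            (+-monoʳ-≤ (X.cycDist x x″) (Y.cycDist-adjacent-≤ a y″))
    torusDist-adjacent-≤ {x , y} {x′ , .y} (inj₂ (refl , a)) (x″ , y″) =
      +-monoˡ-≤ (Y.cycDist y y″) (X.cycDist-adjacent-≤ a x″)

    horizontal : ∀ {x x′ t} y → Walk (Cycle m) x x′ t → Walk (Cycle m □ Cycle n) (x , y) (x′ , y) t
    horizontal y here = here
    horizontal y (step a p) = step (inj₂ (refl , a)) (horizontal y p)

    vertical : ∀ x {y y′ t} → Walk (Cycle n) y y′ t → Walk (Cycle m □ Cycle n) (x , y) (x , y′) t
    vertical x here = here
    vertical x (step a p) = step (inj₁ (refl , a)) (vertical x p)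

  torusDist-Dist : ∀ u v → Dist (Cycle m □ Cycle n) u v (torusDist u v)
  torusDist-Dist (x , y) (x′ , y′) =
    lipschitz⇒Dist (Cycle m □ Cycle n) torusDist torusDist-refl torusDist-adjacent-≤
      (walk-++ (horizontal y (X.walk-cycDist x x′)) (vertical x′ (Y.walk-cycDist y y′)))

  equidistant : ∀ u v w {i j i′ j′} →
    X.cycDist (proj₁ u) (proj₁ v) ≡ i → Y.cycDist (proj₂ u) (proj₂ v) ≡ j →
    X.cycDist (proj₁ v) (proj₁ w) ≡ i′ → Y.cycDist (proj₂ v) (proj₂ w) ≡ j′ →
    i + j ≡ i′ + j′ → torusDist u v ≡ torusDist v w
  equidistant _ _ _ refl refl refl refl i+j≡i′+j′ = i+j≡i′+j′

  reflect : Vertex → Vertex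
  reflect (x , y) = X.mirror x , y

  reflect-isometry : ∀ u v → torusDist (reflect u) (reflect v) ≡ torusDist u v
  reflect-isometry (x , y) (x′ , y′) = cong (_+ Y.cycDist y y′) (X.cycDist-mirror x x′)

  anyVertex? : {P : Vertex → Set} → (∀ v → Dec (P v)) → Dec (∃ P)
  anyVertex? P? = map′ (λ (x , y , p) → (x , y) , p) (λ ((x , y) , p) → x , y , p)
                       (any? λ x → any? λ y → P? (x , y))

  rainbow3AP? : ∀ {r} (c : Vertex → Fin r) → Dec (Rainbow3AP torusDist c)
  rainbow3AP? c = anyVertex? λ v₁ → anyVertex? λ v₂ → anyVertex? λ v₃ →
    (torusDist v₁ v₂ ℕ.≟ torusDist v₂ v₃) ×-dec ¬? (c v₁ ≟ c v₂) ×-dec ¬? (c v₂ ≟ c v₃) ×-dec ¬? (c v₁ ≟ c v₃)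

  module _ (2≤m : 2 ≤ m) {c : Vertex → Fin 3} (surj : Surjective c)
           (monochromatic : ∀ x y → c (x X.⊕ 1 , y) ≡ c (x , y)) where

    private
      x₀ : Fin m
      x₀ = proj₁ (proj₁ (surj zero))

      f : Fin n → Fin 3
      f y = c (x₀ , y)

      c≡f : ∀ x y → c (x , y) ≡ f y
      c≡f x y = X.⊕1-invariant⇒constant (λ x → c (x , y)) (λ x → monochromatic x y) x₀ x

      f-not-constant : ¬ (∀ y → f (y Y.⊕ 1) ≡ f y)
      f-not-constant f-invariant = zero≢one (begin
        zero               ≡⟨ proj₂ (surj zero) ⟨
        c (proj₁ (surj zero)) ≡⟨ c-constant (proj₁ (surj zero)) (proj₁ (surj (suc zero))) ⟩
        c (proj₁ (surj (suc zero))) ≡⟨ proj₂ (surj (suc zero)) ⟩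
        suc zero           ∎)
        where
        open ≡-Reasoning
        zero≢one : zero {2} ≢ suc zero
        zero≢one ()
        c-constant : ∀ u v → c u ≡ c v
        c-constant (x , y) (x′ , y′) = trans (c≡f x y) (trans (Y.⊕1-invariant⇒constant f f-invariant y′ y) (sym (c≡f x′ y′)))

    monochromatic-rows⇒Rainbow3AP : Rainbow3AP torusDist c
    monochromatic-rows⇒Rainbow3AP with any? (λ y → ¬? (f (y Y.⊕ 1) ≟ f y))
    ... | no none = ⊥-elim (f-not-constant (λ y → decidable-stable (f (y Y.⊕ 1) ≟ f y) (λ ne → none (y , ne))))
    ... | yes (y , f⁺≢f) = with-third (third-colour (f y) (f (y Y.⊕ 1)) (f⁺≢f ∘ sym))
      where
      with-third : (∃ λ t → Distinct3 (f y) (f (y Y.⊕ 1)) t) → Rainbow3AP torusDist c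
      with-third (t , (fy≢fy⁺ , fy⁺≢t , fy≢t)) = by-cases (<-cmp α β)
        where
        j : Fin n
        j = proj₂ (proj₁ (surj t))
        fj≡t : f j ≡ t
        fj≡t = trans (sym (c≡f _ j)) (proj₂ (surj t))
        α = Y.cycDist j y
        β = Y.cycDist j (y Y.⊕ 1)
        triple : ∀ x₁ x₃ → torusDist (x₁ , y) (x₀ , j) ≡ torusDist (x₀ , j) (x₃ , y Y.⊕ 1) → Rainbow3AP torusDist c
        triple x₁ x₃ D≡ = (x₁ , y) , (x₀ , j) , (x₃ , y Y.⊕ 1) , D≡ ,
          (λ e → fy≢t (trans (sym (c≡f x₁ y)) (trans e fj≡t))) ,
          (λ e → fy⁺≢t (sym (trans (sym fj≡t) (trans e (c≡f x₃ _))))) ,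
          (λ e → fy≢fy⁺ (trans (sym (c≡f x₁ y)) (trans e (c≡f x₃ _))))
        one : X.cycDist (x₀ X.⊕ 1) x₀ ≡ 1
        one = trans (X.cycDist-sym (x₀ X.⊕ 1) x₀) (X.cycDist-⊕1≡1 2≤m x₀)
        by-cases : Tri (α < β) (α ≡ β) (β < α) → Rainbow3AP torusDist c
        by-cases (tri≈ _ α≡β _) = triple x₀ x₀ (cong (X.cycDist x₀ x₀ +_) (trans (Y.cycDist-sym y j) α≡β))
        by-cases (tri< α<β _ _) = triple (x₀ X.⊕ 1) x₀ (begin
          X.cycDist (x₀ X.⊕ 1) x₀ + Y.cycDist y j ≡⟨ cong₂ _+_ one (Y.cycDist-sym y j) ⟩
          suc α                                  ≡⟨ ≤-antisym α<β (proj₁ (Y.cycDist-⊕1-≤ j y)) ⟩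
          β                                      ≡⟨ cong (_+ β) (X.cycDist-refl x₀) ⟨
          X.cycDist x₀ x₀ + β                    ∎)
          where open ≡-Reasoning
        by-cases (tri> _ _ β<α) = triple x₀ (x₀ X.⊕ 1) (begin
          X.cycDist x₀ x₀ + Y.cycDist y j        ≡⟨ cong₂ _+_ (X.cycDist-refl x₀) (Y.cycDist-sym y j) ⟩
          α                                      ≡⟨ ≤-antisym (proj₂ (Y.cycDist-⊕1-≤ j y)) β<α ⟩
          suc β                                  ≡⟨ cong (_+ β) (X.cycDist-⊕1≡1 2≤m x₀) ⟨
          X.cycDist x₀ (x₀ X.⊕ 1) + β            ∎)
          where open ≡-Reasoning

module OddTorus (k n : ℕ) .{{_ : NonZero n}} (k≥1 : 1 ≤ k) (n≥2 : 2 ≤ n) where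

  N : ℕ
  N = suc (k + k)

  open Torus N n
  open X

  2≤N : 2 ≤ N
  2≤N = s≤s (≤-trans k≥1 (m≤m+n k k))

  arc≤k : ∀ t → arc t ≤ k
  arc≤k t with ≤-<-connex t k
  ... | inj₁ t≤k = ≤-trans (m⊓n≤m t (N ∸ t)) t≤k
  ... | inj₂ k<t = ≤-trans (m⊓n≤n t (N ∸ t)) (≤-trans (∸-monoʳ-≤ N k<t) (≤-reflexive (m+n∸m≡n k k)))

  cycDist≤k : ∀ i j → cycDist i j ≤ k
  cycDist≤k i j = arc≤k ∣ toℕ i - toℕ j ∣

  cycDist-⊕-≤k : ∀ o t → t ≤ k → cycDist o (o ⊕ t) ≡ t
  cycDist-⊕-≤k o t t≤k = trans (cycDist-⊕ o t t≤N) (arc-small (≤-trans t≤k (≤-trans (n≤1+n k) k<N∸t)))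
    where
    t≤N : t ≤ N
    t≤N = ≤-trans t≤k (≤-trans (m≤m+n k k) (n≤1+n _))
    k<N∸t : suc k ≤ N ∸ t
    k<N∸t = subst (_≤ N ∸ t) (m+n∸n≡m (suc k) k) (∸-monoʳ-≤ N t≤k)

  cycDist-shift : ∀ o i j t → i + t ≡ j → t ≤ k → cycDist (o ⊕ i) (o ⊕ j) ≡ t
  cycDist-shift o i j t i+t≡j t≤k =
    trans (cong (cycDist (o ⊕ i)) (trans (cong (o ⊕_) (sym i+t≡j)) (sym (⊕-assoc o i t)))) (cycDist-⊕-≤k (o ⊕ i) t t≤k)

  cycDist-shift′ : ∀ o i j t → i + t ≡ j → t ≤ k → cycDist (o ⊕ j) (o ⊕ i) ≡ t
  cycDist-shift′ o i j t i+t≡j t≤k = trans (cycDist-sym (o ⊕ j) (o ⊕ i)) (cycDist-shift o i j t i+t≡j t≤k)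

  slack<k : ∀ {d e} → suc d + e ≡ k → suc e ≤ k
  slack<k {d} {e} k≡ = subst (suc e ≤_) k≡ (s≤s (m≤n+m e d))

  antipode : Fin N → Fin N
  antipode a = a ⊕ suc k

  antipode-⊕k : ∀ a → antipode a ⊕ k ≡ a
  antipode-⊕k a = trans (⊕-assoc a (suc k) k) (⊕-periodʳ a)

  antipode-⊕suc-k : ∀ a → antipode a ⊕ suc k ≡ a ⊕ 1
  antipode-⊕suc-k a =
    trans (⊕-assoc a (suc k) (suc k)) (trans (cong (a ⊕_) (trans (cong suc (+-suc k k)) (+-comm 1 N))) (⊕-period a 1))

  antipode-⊕k′ : ∀ o → antipode (o ⊕ k) ≡ o
  antipode-⊕k′ o = trans (⊕-assoc o k (suc k)) (trans (cong (o ⊕_) (+-suc k k)) (⊕-periodʳ o))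

  cycDist-antipode : ∀ a → cycDist a (antipode a) ≡ k
  cycDist-antipode a = begin
    cycDist a (antipode a)                ≡⟨ cong (λ x → cycDist x (antipode a)) (antipode-⊕k a) ⟨
    cycDist (antipode a ⊕ k) (antipode a) ≡⟨ cycDist-sym (antipode a ⊕ k) (antipode a) ⟩
    cycDist (antipode a) (antipode a ⊕ k) ≡⟨ cycDist-⊕-≤k (antipode a) k ≤-refl ⟩
    k                                     ∎
    where open ≡-Reasoning

  cycDist-antipode-⊕1 : ∀ a → cycDist (antipode a) (a ⊕ 1) ≡ k
  cycDist-antipode-⊕1 a = begin
    cycDist (antipode a) (a ⊕ 1) ≡⟨ cong (λ x → cycDist x (a ⊕ 1)) (⊕-assoc a 1 k) ⟨
    cycDist (a ⊕ 1 ⊕ k) (a ⊕ 1)  ≡⟨ cycDist-sym (a ⊕ 1 ⊕ k) (a ⊕ 1) ⟩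
    cycDist (a ⊕ 1) (a ⊕ 1 ⊕ k)  ≡⟨ cycDist-⊕-≤k (a ⊕ 1) k ≤-refl ⟩
    k                            ∎
    where open ≡-Reasoning

  -- A bichromatic horizontal edge with an apex of the third colour; δ is the horizontal
  -- distance from the apex to the column equidistant from both ends of the edge.
  record Config (c : Vertex → Fin 3) (δ : ℕ) : Set where
    constructor config
    field
      left right : Fin N
      row : Fin n
      apex : Vertex
      adjacent : right ≡ left ⊕ 1
      rainbow : Distinct3 (c (left , row)) (c (right , row)) (c apex)
      offset : cycDist (proj₁ apex) (antipode left) ≡ δ

  offset-slack : ∀ p a {d} → cycDist p (antipode a) ≡ suc d → suc d + (k ∸ suc d) ≡ k
  offset-slack p a offset = m+[n∸m]≡n (subst (_≤ k) offset (cycDist≤k p (antipode a)))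

  module _ {c : Vertex → Fin 3} where

    near-config : ∀ {d} o h q → d ≤ k →
      Distinct3 (c (o ⊕ k , h)) (c (o ⊕ suc k , h)) (c (o ⊕ d , q)) → Config c d
    near-config {d} o h q d≤k distinct = config (o ⊕ k) (o ⊕ suc k) h (o ⊕ d , q) (sym (⊕-suc o k)) distinct
      (trans (cong (cycDist (o ⊕ d)) (antipode-⊕k′ o)) (trans (cycDist-sym (o ⊕ d) o) (cycDist-⊕-≤k o d d≤k)))

    shifted-config : ∀ {d} o q y → d ≤ k →
      Distinct3 (c (o ⊕ d , q)) (c (o ⊕ suc d , q)) (c (o ⊕ suc k , y)) → Config c d
    shifted-config {d} o q y d≤k distinct = config (o ⊕ d) (o ⊕ suc d) q (o ⊕ suc k , y) (sym (⊕-suc o d)) distinct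
      (trans (cong (cycDist (o ⊕ suc k)) (⊕-assoc o d (suc k))) (cycDist-shift o (suc k) (d + suc k) d (+-comm (suc k) d) d≤k))

  module _ {c : Vertex → Fin 3} (rainbow-free : ¬ Rainbow3AP torusDist c) where

    shift-pair : ∀ {a b b′ w r t} → cycDist a b ≡ 1 → cycDist b b′ ≡ 1 →
      cycDist a w ≡ suc (suc t) → cycDist b w ≡ suc t → cycDist b′ w ≡ t →
      Distinct3 (c (a , r)) (c (b , r)) (c (w , r)) →
      c (b , r Y.⊕ 1) ≡ c (a , r) × c (b′ , r Y.⊕ 1) ≡ c (b , r)
    shift-pair {a} {b} {b′} {w} {r} {t} ab bb′ aw bw b′w (α≢β , β≢γ , α≢γ) = above-b , above-b′
      where
      r′ = r Y.⊕ 1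
      up : Y.cycDist r r′ ≡ 1
      up = Y.cycDist-⊕1≡1 n≥2 r
      above-b : c (b , r′) ≡ c (a , r)
      above-b = pinned rainbow-free
        (equidistant (a , r) (b , r) (b , r′) ab (Y.cycDist-refl r) (cycDist-refl b) up refl)
        (equidistant (a , r) (w , r) (b , r′) aw (Y.cycDist-refl r) (trans (cycDist-sym w b) bw) up (solve (t ∷ [])))
        (α≢β , β≢γ , α≢γ)
      above-b′ : c (b′ , r′) ≡ c (b , r)
      above-b′ = pinned rainbow-free
        (equidistant (b , r) (b , r′) (b′ , r′) (cycDist-refl b) up bb′ (Y.cycDist-refl r′) refl)
        (equidistant (b , r) (w , r) (b′ , r′) bw (Y.cycDist-refl r) (trans (cycDist-sym w b′) b′w) up (solve (t ∷ [])))
        ((λ e → α≢β (sym (trans e above-b))) , (λ e → α≢γ (trans (sym above-b) e)) , β≢γ)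

    -- The pairs at both ends move one step inwards and one row up, shrinking the gap by two.
    ladder : ∀ g → suc g ≤ k → ∀ o s r →
      c (o ⊕ s , r) ≡ c (o ⊕ (suc (suc g) + s) , r) →
      ¬ Distinct3 (c (o ⊕ s , r)) (c (o ⊕ suc s , r)) (c (o ⊕ (suc g + s) , r))
    ladder zero _ o s r _ (_ , y≢z , _) = y≢z refl
    ladder (suc zero) _ o s r _ distinct = rainbow-free ((o ⊕ s , r) , (o ⊕ suc s , r) , (o ⊕ (2 + s) , r) ,
      equidistant (o ⊕ s , r) (o ⊕ suc s , r) (o ⊕ (2 + s) , r)
        (cycDist-shift o s (suc s) 1 (+-comm s 1) k≥1) (Y.cycDist-refl r)
        (cycDist-shift o (suc s) (2 + s) 1 (+-comm (suc s) 1) k≥1) (Y.cycDist-refl r) refl ,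
      distinct)
    ladder (suc (suc g)) g+3≤k o s r x≡x′ (x≢y , y≢z , x≢z) =
      ladder g g+1≤k o (suc s) (r Y.⊕ 1)
        (trans (proj₁ near) (trans x≡x′ (sym (trans (cong (λ i → c (o ⊕ i , r Y.⊕ 1)) (+-suc (suc (suc g)) s)) (proj₁ far)))))
        ((λ e → x≢y (trans (sym (proj₁ near)) (trans e (proj₂ near)))) ,
         (λ e → y≢z (trans (sym (proj₂ near)) (trans e (proj₂ far)))) ,
         (λ e → x≢z (trans (sym (proj₁ near)) (trans e (proj₂ far)))))
      where
      z = suc (suc (suc g)) + s
      g+2≤k : suc (suc g) ≤ k
      g+2≤k = ≤-trans (n≤1+n _) g+3≤k
      g+1≤k : suc g ≤ k
      g+1≤k = ≤-trans (n≤1+n _) g+2≤k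
      near = shift-pair {t = suc g}
        (cycDist-shift o s (suc s) 1 (+-comm s 1) k≥1)
        (cycDist-shift o (suc s) (suc (suc s)) 1 (+-comm (suc s) 1) k≥1)
        (cycDist-shift o s z (suc (suc (suc g))) (+-comm s _) g+3≤k)
        (cycDist-shift o (suc s) z (suc (suc g)) (cong suc (+-comm s _)) g+2≤k)
        (cycDist-shift o (suc (suc s)) z (suc g) (cong (λ x → suc (suc x)) (trans (+-suc s g) (cong suc (+-comm s g)))) g+1≤k)
        (x≢y , y≢z , x≢z)
      far = shift-pair {t = suc g}
        (cycDist-shift′ o z (suc z) 1 (+-comm z 1) k≥1)
        (cycDist-shift′ o (suc g + suc s) z 1 (trans (+-comm (suc g + suc s) 1) (cong suc (+-suc (suc g) s))) k≥1)
        (cycDist-shift′ o (suc s) (suc z) (suc (suc (suc g))) (cong suc (+-comm s _)) g+3≤k)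
        (cycDist-shift′ o (suc s) z (suc (suc g)) (cong suc (+-comm s _)) g+2≤k)
        (cycDist-shift′ o (suc s) (suc g + suc s) (suc g) (+-comm (suc s) (suc g)) g+1≤k)
        ((λ e → x≢z (trans x≡x′ e)) , y≢z ∘ sym , (λ e → x≢y (trans x≡x′ e)))

    right-end-toward-apex : ∀ {d e} → suc d + e ≡ k → ∀ o h q {h′} →
      Y.cycDist h h′ ≡ 1 → suc (Y.cycDist h′ q) ≡ Y.cycDist h q →
      Distinct3 (c (o ⊕ k , h)) (c (o ⊕ suc k , h)) (c (o ⊕ suc d , q)) → c (o ⊕ suc k , h′) ≡ c (o ⊕ k , h)
    right-end-toward-apex {d} {e} k≡ o h q {h′} h-h′ h′-q distinct = pinned rainbow-free
      (equidistant (o ⊕ k , h) (o ⊕ suc k , h) (o ⊕ suc k , h′)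
        (cycDist-shift o k (suc k) 1 (+-comm k 1) k≥1) (Y.cycDist-refl h)
        (cycDist-shift o (suc k) (suc k) 0 (+-identityʳ (suc k)) z≤n) h-h′ refl)
      (equidistant (o ⊕ k , h) (o ⊕ suc d , q) (o ⊕ suc k , h′)
        (cycDist-shift′ o (suc d) k e k≡ (≤-trans (n≤1+n e) (slack<k k≡))) refl
        (cycDist-shift o (suc d) (suc k) (suc e) (trans (+-suc (suc d) e) (cong suc k≡)) (slack<k k≡)) refl
        (begin
          e + Y.cycDist h q         ≡⟨ cong (e +_) h′-q ⟨
          e + suc (Y.cycDist h′ q)  ≡⟨ +-suc e _ ⟩
          suc e + Y.cycDist h′ q    ≡⟨ cong (suc e +_) (Y.cycDist-sym h′ q) ⟩
          suc e + Y.cycDist q h′    ∎))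
      distinct
      where open ≡-Reasoning

    descend : ∀ {d e} → suc d + e ≡ k → ¬ Config c d →
      ∀ o h q → ¬ Distinct3 (c (o ⊕ k , h)) (c (o ⊕ suc k , h)) (c (o ⊕ suc d , q))
    descend {d} {e} k≡ no-config o h q distinct@(v≢w , w≢p , v≢p) =
      by-colour (c (o ⊕ d , q) ≟ c (o ⊕ k , h)) (c (o ⊕ d , q) ≟ c (o ⊕ suc k , h))
      where
      d≤k : d ≤ k
      d≤k = subst (d ≤_) k≡ (≤-trans (n≤1+n d) (m≤m+n (suc d) e))
      at-v : c (o ⊕ (suc e + d) , h) ≡ c (o ⊕ k , h)
      at-v = cong (λ i → c (o ⊕ i , h)) (trans (cong suc (+-comm e d)) k≡)
      at-w : c (o ⊕ (suc (suc e) + d) , h) ≡ c (o ⊕ suc k , h)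
      at-w = cong (λ i → c (o ⊕ suc i , h)) (trans (cong suc (+-comm e d)) k≡)
      by-colour : Dec (c (o ⊕ d , q) ≡ c (o ⊕ k , h)) → Dec (c (o ⊕ d , q) ≡ c (o ⊕ suc k , h)) → ⊥
      by-colour (no n≢v) (no n≢w) = no-config (near-config o h q d≤k (v≢w , n≢w ∘ sym , n≢v ∘ sym))
      by-colour (yes n≡v) _ = no-config (shifted-config o q h d≤k
        ((λ x → v≢p (trans (sym n≡v) x)) , w≢p ∘ sym , (λ x → v≢w (trans (sym n≡v) x))))
      by-colour (no _) (yes n≡w) with q ≟ h
      ... | yes refl = ladder e (slack<k k≡) o d q (trans n≡w (sym at-w))
        ((λ x → w≢p (trans (sym n≡w) x)) , (λ x → v≢p (sym (trans x at-v))) ,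
         (λ x → v≢w (sym (trans (sym n≡w) (trans x at-v)))))
      ... | no q≢h with Y.step-toward n≥2 (q≢h ∘ sym)
      ...   | h′ , h-h′ , h′-q = no-config (shifted-config o q h′ d≤k
        ((λ x → w≢p (trans (sym n≡w) x)) , (λ x → v≢p (sym (trans x u≡v))) , (λ x → v≢w (sym (trans (sym n≡w) (trans x u≡v))))))
        where
        u≡v : c (o ⊕ suc k , h′) ≡ c (o ⊕ k , h)
        u≡v = right-end-toward-apex k≡ o h q h-h′ h′-q distinct

  no-config : ∀ δ {c} → ¬ Rainbow3AP torusDist c → ¬ Config c δ
  no-config zero rainbow-free (config left .(left ⊕ 1) row (p , q) refl (l≢r , r≢a , l≢a) offset)
    with cycDist≡0⇒≡ {p} {antipode left} offset
  ... | refl = rainbow-free ((left , row) , (antipode left , q) , (left ⊕ 1 , row) ,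
    cong₂ _+_ (trans (cycDist-antipode left) (sym (cycDist-antipode-⊕1 left))) (Y.cycDist-sym row q) ,
    l≢a , r≢a ∘ sym , l≢r)
  no-config (suc d) {c} rainbow-free (config left right row (p , q) right≡ distinct offset)
    with cycDist≡⇒⊕ (antipode left) p (suc d) (trans (cycDist-sym (antipode left) p) offset)
  ... | inj₁ p≡ = descend rainbow-free (offset-slack p left offset) (no-config d rainbow-free) (antipode left) row q
    (Distinct3-cong (cong (λ x → c (x , row)) (sym (antipode-⊕k left)))
                    (cong (λ x → c (x , row)) (trans right≡ (sym (antipode-⊕suc-k left))))
                    (cong (λ x → c (x , q)) p≡) distinct)
  -- The apex lies on the other side of the equidistant column: reflect the colouring.
  ... | inj₂ o≡ = descend reflected-free (offset-slack p left offset) (no-config d reflected-free) (mirror (antipode left)) row q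
    (Distinct3-cong (cong (λ x → c (x , row)) (sym (mirror-⊕-flip k right⊕k≡o)))
                    (cong (λ x → c (x , row)) (sym (mirror-⊕-flip (suc k) refl)))
                    (cong (λ x → c (x , q)) (sym (mirror-⊕-flip (suc d) (sym o≡))))
                    (Distinct3-swap₁₂ distinct))
    where
    reflected-free : ¬ Rainbow3AP torusDist (c ∘ reflect)
    reflected-free = rainbow-free ∘ Rainbow3AP-isometry reflect reflect-isometry
    right⊕k≡o : right ⊕ k ≡ antipode left
    right⊕k≡o = trans (cong (_⊕ k) right≡) (⊕-assoc left 1 k)

  surjective⇒Rainbow3AP : (c : Vertex → Fin 3) → Surjective c → Rainbow3AP torusDist c
  surjective⇒Rainbow3AP c surj with rainbow3AP? c
  ... | yes rainbow = rainbow
  ... | no rainbow-free with anyVertex? (λ (x , y) → ¬? (c (x ⊕ 1 , y) ≟ c (x , y)))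
  ...   | no none = ⊥-elim (rainbow-free (monochromatic-rows⇒Rainbow3AP 2≤N surj
          (λ x y → decidable-stable (c (x ⊕ 1 , y) ≟ c (x , y)) (λ ne → none ((x , y) , ne)))))
  ...   | yes ((x , y) , bichromatic) with third-colour (c (x , y)) (c (x ⊕ 1 , y)) (bichromatic ∘ sym)
  ...     | t , (l≢r , r≢t , l≢t) with surj t
  ...       | a , ca≡t = ⊥-elim (no-config _ rainbow-free
              (config x (x ⊕ 1) y a refl (l≢r , (λ e → r≢t (trans e ca≡t)) , (λ e → l≢t (trans e ca≡t))) refl))

odd-column⇒rainbow : ∀ k n .{{_ : NonZero n}} → 1 ≤ k → 2 ≤ n →
  EveryExactColoringRainbow (Cycle (suc (k + k)) □ Cycle n) 3
odd-column⇒rainbow k n k≥1 n≥2 c surj =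
  Rainbow3AP⇒HasRainbow3AP _ torusDist torusDist-Dist (surjective⇒Rainbow3AP c surj)
  where
  open Torus (suc (k + k)) n
  open OddTorus k n k≥1 n≥2

torusDist-swap : ∀ m n .{{_ : NonZero m}} .{{_ : NonZero n}} (u v : Fin m × Fin n) →
  Torus.torusDist n m (swap u) (swap v) ≡ Torus.torusDist m n u v
torusDist-swap m n (x , y) (x′ , y′) = +-comm (Torus.Y.cycDist m n y y′) (Torus.X.cycDist m n x x′)

odd-row⇒rainbow : ∀ m k .{{_ : NonZero m}} → 1 ≤ k → 2 ≤ m →
  EveryExactColoringRainbow (Cycle m □ Cycle (suc (k + k))) 3
odd-row⇒rainbow m k k≥1 m≥2 c surj =
  Rainbow3AP⇒HasRainbow3AP _ (Torus.torusDist m N) (Torus.torusDist-Dist m N)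
    (Rainbow3AP-isometry swap (torusDist-swap N m)
      (OddTorus.surjective⇒Rainbow3AP k m k≥1 m≥2 (c ∘ swap) λ b → swap (proj₁ (surj b)) , proj₂ (surj b)))
  where
  N = suc (k + k)

few-colours : ∀ {r} → r < 3 → (x y z : Fin r) → ¬ Distinct3 x y z
few-colours {1} _ zero zero _ (x≢y , _) = x≢y refl
few-colours {2} _ zero zero _ (x≢y , _) = x≢y refl
few-colours {2} _ (suc zero) (suc zero) _ (x≢y , _) = x≢y refl
few-colours {2} _ zero (suc zero) zero (_ , _ , x≢z) = x≢z refl
few-colours {2} _ zero (suc zero) (suc zero) (_ , y≢z , _) = y≢z refl
few-colours {2} _ (suc zero) zero zero (_ , y≢z , _) = y≢z refl
few-colours {2} _ (suc zero) zero (suc zero) (_ , _ , x≢z) = x≢z refl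
few-colours {suc (suc (suc _))} (s≤s (s≤s (s≤s ())))

few-colours⇒no-rainbow : ∀ (G : Graph) {r} → r < 3 → (c : V G → Fin r) → ¬ HasRainbow3AP G c
few-colours⇒no-rainbow G r<3 c (v₁ , v₂ , v₃ , _ , _ , _ , distinct) = few-colours r<3 (c v₁) (c v₂) (c v₃) distinct

fewer-colours-fail : ∀ {m n} → 2 ≤ m → 1 ≤ n → ∀ s → 1 ≤ s → s < 3 → ¬ EveryExactColoringRainbow (Cycle m □ Cycle n) s
fewer-colours-fail (s≤s (s≤s _)) (s≤s _) 1 _ s<3 every =
  few-colours⇒no-rainbow _ s<3 _ (every (λ _ → zero) λ { zero → (zero , zero) , refl })
fewer-colours-fail (s≤s (s≤s _)) (s≤s _) 2 _ s<3 every =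
  few-colours⇒no-rainbow _ s<3 _ (every first-column λ { zero → (zero , zero) , refl ; (suc zero) → (suc zero , zero) , refl })
  where
  first-column : Fin _ × Fin _ → Fin 2
  first-column (zero , _) = zero
  first-column (suc _ , _) = suc zero
fewer-colours-fail _ _ (suc (suc (suc _))) _ (s≤s (s≤s (s≤s ())))

odd⇒suc-double : ∀ m → ¬ 2 ∣ m → ∃ λ k → m ≡ suc (k + k)
odd⇒suc-double m 2∤m with m % 2 in m%2 | m%n<n m 2
... | zero | _ = ⊥-elim (2∤m (m%n≡0⇒n∣m m 2 m%2))
... | suc zero | _ = m / 2 , (begin
  m                   ≡⟨ m≡m%n+[m/n]*n m 2 ⟩
  m % 2 + m / 2 * 2   ≡⟨ cong (_+ m / 2 * 2) m%2 ⟩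
  suc (m / 2 * 2)     ≡⟨ cong suc (trans (*-comm (m / 2) 2) (cong (m / 2 +_) (+-identityʳ (m / 2)))) ⟩
  suc (m / 2 + m / 2) ∎)
  where open ≡-Reasoning
... | suc (suc _) | s≤s (s≤s ())

3≤2k+1⇒1≤k : ∀ {k} → 3 ≤ suc (k + k) → 1 ≤ k
3≤2k+1⇒1≤k {zero} (s≤s ())
3≤2k+1⇒1≤k {suc _} _ = s≤s z≤n

corollary3 : (m n : ℕ) → 3 ≤ m → 3 ≤ n → (¬ (2 ∣ m) ⊎ ¬ (2 ∣ n)) →
    IsAW3 (Cycle m □ Cycle n) 3
corollary3 m n 3≤m 3≤n odd =
  s≤s z≤n , three-colours odd , fewer-colours-fail (≤-trans (n≤1+n 2) 3≤m) (≤-trans (s≤s z≤n) 3≤n)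
  where
  three-colours : ¬ 2 ∣ m ⊎ ¬ 2 ∣ n → EveryExactColoringRainbow (Cycle m □ Cycle n) 3
  three-colours (inj₁ m-odd) with odd⇒suc-double m m-odd
  ... | k , refl = odd-column⇒rainbow k n {{>-nonZero (≤-trans (s≤s z≤n) 3≤n)}} (3≤2k+1⇒1≤k 3≤m) (≤-trans (n≤1+n 2) 3≤n)
  three-colours (inj₂ n-odd) with odd⇒suc-double n n-odd
  ... | k , refl = odd-row⇒rainbow m k {{>-nonZero (≤-trans (s≤s z≤n) 3≤m)}} (3≤2k+1⇒1≤k 3≤n) (≤-trans (n≤1+n 2) 3≤m)
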